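{- Let $\mathcal P$ be a formal logic program over $\mathscr V^\star$ and $\Omega$ a literal marker for $\mathcal P$. For all sets $E$ and $F$ of literals, if $E\subseteq F$ then $[\mathcal P+_\Omega E]\subseteq[\mathcal P+_\Omega F]$.
   Context: Syntax. $\mathscr V$ is a vocabulary: a set of function symbols and predicate symbols, each with an arity (possibly $0$), not containing the binary logical symbol $\doteq$ (syntactic identity). $\mathscr V^\star$ is a countable subset of $\mathscr V$. Variables come from a fixed repetition-free enumeration $(v_i)_{i\in\mathbb N}$. Terms over $\mathscr V$ (resp. $\mathscr V^\star$) are built from variables and function symbols of $\mathscr V$ (resp. $\mathscr V^\star$); closed terms contain no variables. Statements over $\mathscr V$ form the smallest set containing literals (atoms $\wp(t_1,\dots,t_n)$ and negated atoms $\neg\wp(t_1,\dots,t_n)$), identities $t\doteq t'$, distinctions $t\not\doteq t'$, $\bigvee X$ and $\bigwedge X$ for countable sets $X$ of statements, and $\exists x\,\varphi$, $\forall x\,\varphi$ whenever $x$ is free in $\varphi$; statements over $\mathscr V^\star$ likewise. $e[t_1/x_1,\dots,t_n/x_n]$ is simultaneous substitution of closed terms for free variables. An instance of $e$ is a closed expression $e[t_1/x_1,\dots,t_n/x_n]$; a tuple $(t'_1,\dots,t'_n)$ of closed terms is an instance of $(t_1,\dots,t_n)$ iff each $t'_i$ is an instance of $t_i$. A set $S$ of literals is consistent iff no closed atom $\varphi$ has both $\varphi$ and $\neg\varphi$ as instances of members of $S$. Forcing. For a consistent set $S$ of closed literals and closed statements: $S\Vdash t\doteq t'$ iff identical; $S\Vdash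 t\not\doteq t'$ iff distinct; $S\Vdash\lambda$ (literal) iff $\lambda\in S$; $\bigvee X$ iff some member forced; $\bigwedge X$ iff all; $\exists x\varphi$ iff $\varphi[t/x]$ forced for some closed term $t$ over $\mathscr V$; $\forall x\varphi$ iff for all. For arbitrary $S$ and a statement or set of statements $T$: $S\Vdash T$ iff $S$ is inconsistent or the closed instances of members of $S$ force every closed instance of (every member of) $T$. Programs. A formal logic program over $\mathscr V^\star$ is a family $\mathcal P=((\varphi^+_\wp,\varphi^-_\wp))_\wp$ indexed by the predicate symbols of $\mathscr V^\star$, with $\varphi^\pm_\wp$ statements over $\mathscr V^\star$ with free variables among $v_1,\dots,v_n$ for $n$-ary $\wp$. $[\mathcal P]$ is the $\subseteq$-least set of literals over $\mathscr V^\star$ such that for all $n$-ary $\wp$ of $\mathscr V^\star$ and terms $t_1,\dots,t_n$ over $\mathscr V^\star$: $\wp(t_1,\dots,t_n)\in[\mathcal P]$ iff $[\mathcal P]\Vdash\varphi^+_\wp[t'_1/v_1,\dots,t'_n/v_n]$ for every instance $(t'_1,\dots,t'_n)$ of $(t_1,\dots,t_n)$, and likewise for $\neg\wp(t_1,\dots,t_n)$ with $\varphi^-_\wp$. Transformations. An occurrence of a literal in a statement $\varphi$ is a leaf of the parse tree of $\varphi$ labelled by that literal (formally, the set of substatements along the branch to that leaf). A literal marker for $\mathcal P$ is a family $\Omega=((O^+_\wp,O^-_\wp))_\wp$ with $O^\pm_\wp$ a set of occurrences of literals in $\varphi^\pm_\wp$. For a literal $\lambda$ with free variables exactly the distinct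 $x_1,\dots,x_n$ and a set $E$ of literals, $U(\lambda,E)$ is the set of all statements $\exists y_1\dots\exists y_m(x_1\doteq t_1\wedge\dots\wedge x_n\doteq t_n)$ with $t_i$ terms over $\mathscr V^\star$, $y_1,\dots,y_m$ the distinct variables occurring in the $t_i$ (all distinct from the $x_i$), such that for every instance $(t'_1,\dots,t'_n)$ of $(t_1,\dots,t_n)$, $\lambda[t'_1/x_1,\dots,t'_n/x_n]$ is an instance of a member of $E$ (for $n=0$: $\{\bigwedge\varnothing\}$ if $\lambda$ is an instance of a member of $E$, else $\varnothing$). $\circledcirc^O_E\varphi$ is obtained from $\varphi$ by replacing each occurrence in $O$ of a literal $\lambda$ by $\bigvee(\{\lambda\}\cup U(\lambda,E))$. $\mathcal P+_\Omega E=((\circledcirc^{O^+_\wp}_E\varphi^+_\wp,\circledcirc^{O^-_\wp}_E\varphi^-_\wp))_\wp$. -}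

module Defs where

open import Level using (Level; _⊔_) renaming (suc to lsuc; zero to lzero)
open import Data.Nat using (ℕ; zero; suc; _≤_; _≡ᵇ_)
open import Data.Bool using (Bool; true; false; if_then_else_)
open import Data.Maybe using (Maybe; just; nothing; fromMaybe)
open import Data.Vec using (Vec; []; _∷_)
import Data.Vec as Vec
open import Data.Vec.Relation.Binary.Pointwise.Inductive using (Pointwise)
open import Data.List using (List; length)
import Data.List as List
open import Data.List.Membership.Propositional using (_∈_; _∉_)
open import Data.List.Relation.Unary.Unique.Propositional using (Unique)
open import Data.Product using (Σ; _×_; _,_; proj₁)
open import Data.Sum using (_⊎_; inj₁; inj₂; [_,_])
import Data.Sum as Sum
open import Data.Unit using (⊤; tt)
open import Data.Empty using (⊥)
open import Data.Fin using (Fin)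
open import Relation.Binary.PropositionalEquality using (_≡_; _≢_)
open import Relation.Nullary using (¬_)

Countable : Set → Set
Countable A = Σ (A → ℕ) λ f → ∀ a b → f a ≡ f b → a ≡ b

-- A vocabulary 𝒱 (function and predicate symbols with arities) together with
-- a countable sub-vocabulary 𝒱★ (given by the predicates Fun★, Pred★).
-- The identity symbol ≐ is a logical symbol of the syntax below, not a member of 𝒱.
record Vocabulary : Set₁ where
  field
    Fun    : Set
    Pred   : Set
    farity : Fun → ℕ
    parity : Pred → ℕ
    Fun★   : Fun → Set
    Pred★  : Pred → Set
    countable★ : Σ ((Σ Fun Fun★ ⊎ Σ Pred Pred★) → ℕ) λ f →
                   ∀ a b → f a ≡ f b → Sum.map proj₁ proj₁ a ≡ Sum.map proj₁ proj₁ b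

module Syntax (V : Vocabulary) where
  open Vocabulary V

  data Term : Set where
    var : ℕ → Term
    app : (f : Fun) → Vec Term (farity f) → Term

  data TermIn (F : Fun → Set) (X : ℕ → Set) : Term → Set
  data TermsIn (F : Fun → Set) (X : ℕ → Set) : {n : ℕ} → Vec Term n → Set
  data TermIn F X where
    var : ∀ {i} → X i → TermIn F X (var i)
    app : ∀ {f ts} → F f → TermsIn F X ts → TermIn F X (app f ts)
  data TermsIn F X where
    []  : TermsIn F X []
    _∷_ : ∀ {n t} {ts : Vec Term n} → TermIn F X t → TermsIn F X ts → TermsIn F X (t ∷ ts)

  ClosedT : Term → Set
  ClosedT = TermIn (λ _ → ⊤) (λ _ → ⊥)

  Term★ : Term → Set
  Term★ = TermIn Fun★ (λ _ → ⊤)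

  Terms★ : {n : ℕ} → Vec Term n → Set
  Terms★ = TermsIn Fun★ (λ _ → ⊤)

  data OccT (x : ℕ) : Term → Set
  data OccTs (x : ℕ) : {n : ℕ} → Vec Term n → Set
  data OccT x where
    var : OccT x (var x)
    app : ∀ {f ts} → OccTs x ts → OccT x (app f ts)
  data OccTs x where
    here  : ∀ {n t} {ts : Vec Term n} → OccT x t → OccTs x (t ∷ ts)
    there : ∀ {n t} {ts : Vec Term n} → OccTs x ts → OccTs x (t ∷ ts)

  Sub : Set
  Sub = ℕ → Maybe Term

  ClosedSub : Sub → Set
  ClosedSub σ = ∀ i t → σ i ≡ just t → ClosedT t

  substT  : Sub → Term → Term
  substTs : Sub → {n : ℕ} → Vec Term n → Vec Term n
  substT σ (var i)    = fromMaybe (var i) (σ i)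
  substT σ (app f ts) = app f (substTs σ ts)
  substTs σ []       = []
  substTs σ (t ∷ ts) = substT σ t ∷ substTs σ ts

  _without_ : Sub → ℕ → Sub
  (σ without x) y = if y ≡ᵇ x then nothing else σ y

  single : ℕ → Term → Sub
  single x t y = if y ≡ᵇ x then just t else nothing

  assign : (xs : List ℕ) → Vec Term (length xs) → Sub
  assign List.[]       []       y = nothing
  assign (x List.∷ xs) (t ∷ ts) y = if y ≡ᵇ x then just t else assign xs ts y

  nth : {n : ℕ} → Vec Term n → ℕ → Maybe Term
  nth []       k       = nothing
  nth (t ∷ ts) zero    = just t
  nth (t ∷ ts) (suc k) = nth ts k

  vsub : {n : ℕ} → Vec Term n → Sub
  vsub ts zero    = nothing
  vsub ts (suc k) = nth ts k

  InstT : Term → Term → Set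
  InstT t' t = ClosedT t' × Σ Sub λ σ → ClosedSub σ × (t' ≡ substT σ t)

  InstTs : {n : ℕ} → Vec Term n → Vec Term n → Set
  InstTs = Pointwise InstT

  data Lit : Set where
    pos : (p : Pred) → Vec Term (parity p) → Lit
    neg : (p : Pred) → Vec Term (parity p) → Lit

  substL : Sub → Lit → Lit
  substL σ (pos p ts) = pos p (substTs σ ts)
  substL σ (neg p ts) = neg p (substTs σ ts)

  FreeL : ℕ → Lit → Set
  FreeL x (pos p ts) = OccTs x ts
  FreeL x (neg p ts) = OccTs x ts

  ClosedL : Lit → Set
  ClosedL l = ∀ x → ¬ FreeL x l

  Lit★ : Lit → Set
  Lit★ (pos p ts) = Pred★ p × Terms★ ts
  Lit★ (neg p ts) = Pred★ p × Terms★ ts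

  InstL : Lit → Lit → Set
  InstL l' l = ClosedL l' × Σ Sub λ σ → ClosedSub σ × (l' ≡ substL σ l)

  InstOf : ∀ {ℓ} → (Lit → Set ℓ) → Lit → Set ℓ
  InstOf S l' = Σ Lit λ l → S l × InstL l' l

  -- A countable set X of statements is represented by a
  -- family  X : I → Stmt  (its set of members is the image of X); the
  -- well-formedness predicate StmtIn below requires I to be countable.

  infix 4 _≐_ _≭_
  data Stmt : Set₁ where
    lit : Lit → Stmt
    _≐_ : Term → Term → Stmt
    _≭_ : Term → Term → Stmt
    ⋁   : {I : Set} → (I → Stmt) → Stmt
    ⋀   : {I : Set} → (I → Stmt) → Stmt
    ∃'  : ℕ → Stmt → Stmt
    ∀'  : ℕ → Stmt → Stmt

  data Free (x : ℕ) : Stmt → Set₁ where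
    lit : ∀ {l} → FreeL x l → Free x (lit l)
    ≐ˡ  : ∀ {t t'} → OccT x t  → Free x (t ≐ t')
    ≐ʳ  : ∀ {t t'} → OccT x t' → Free x (t ≐ t')
    ≭ˡ  : ∀ {t t'} → OccT x t  → Free x (t ≭ t')
    ≭ʳ  : ∀ {t t'} → OccT x t' → Free x (t ≭ t')
    ⋁   : ∀ {I} {X : I → Stmt} (i : I) → Free x (X i) → Free x (⋁ X)
    ⋀   : ∀ {I} {X : I → Stmt} (i : I) → Free x (X i) → Free x (⋀ X)
    ∃'  : ∀ {y φ} → x ≢ y → Free x φ → Free x (∃' y φ)
    ∀'  : ∀ {y φ} → x ≢ y → Free x φ → Free x (∀' y φ)

  ClosedS : Stmt → Set₁
  ClosedS φ = ∀ x → ¬ Free x φ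

  data StmtIn (F : Fun → Set) (P : Pred → Set) : Stmt → Set₁ where
    pos : ∀ {p ts} → P p → TermsIn F (λ _ → ⊤) ts → StmtIn F P (lit (pos p ts))
    neg : ∀ {p ts} → P p → TermsIn F (λ _ → ⊤) ts → StmtIn F P (lit (neg p ts))
    eq  : ∀ {t t'} → TermIn F (λ _ → ⊤) t → TermIn F (λ _ → ⊤) t' → StmtIn F P (t ≐ t')
    neq : ∀ {t t'} → TermIn F (λ _ → ⊤) t → TermIn F (λ _ → ⊤) t' → StmtIn F P (t ≭ t')
    ⋁   : ∀ {I} {X : I → Stmt} → Countable I → (∀ i → StmtIn F P (X i)) → StmtIn F P (⋁ X)
    ⋀   : ∀ {I} {X : I → Stmt} → Countable I → (∀ i → StmtIn F P (X i)) → StmtIn F P (⋀ X)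
    ∃'  : ∀ {x φ} → Free x φ → StmtIn F P φ → StmtIn F P (∃' x φ)
    ∀'  : ∀ {x φ} → Free x φ → StmtIn F P φ → StmtIn F P (∀' x φ)

  Stmt★ : Stmt → Set₁
  Stmt★ = StmtIn Fun★ Pred★

  -- substitution (only ever used with closed terms, so no capture)
  substS : Sub → Stmt → Stmt
  substS σ (lit l)   = lit (substL σ l)
  substS σ (t ≐ t')  = substT σ t ≐ substT σ t'
  substS σ (t ≭ t')  = substT σ t ≭ substT σ t'
  substS σ (⋁ X)     = ⋁ (λ i → substS σ (X i))
  substS σ (⋀ X)     = ⋀ (λ i → substS σ (X i))
  substS σ (∃' x φ)  = ∃' x (substS (σ without x) φ)
  substS σ (∀' x φ)  = ∀' x (substS (σ without x) φ)

  -- S ⊩ φ for a (consistent) set S of closed literals and a closed statement φ;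
  -- the clauses of the paper, read as an inductive definition.
  data _⊩c_ {ℓ} (S : Lit → Set ℓ) : Stmt → Set (lsuc lzero ⊔ ℓ) where
    lit : ∀ {l} → S l → S ⊩c lit l
    eq  : ∀ {t t'} → t ≡ t' → S ⊩c (t ≐ t')
    neq : ∀ {t t'} → t ≢ t' → S ⊩c (t ≭ t')
    ⋁   : ∀ {I} {X : I → Stmt} (i : I) → S ⊩c X i → S ⊩c ⋁ X
    ⋀   : ∀ {I} {X : I → Stmt} → (∀ i → S ⊩c X i) → S ⊩c ⋀ X
    ∃'  : ∀ {x φ} (t : Term) → ClosedT t → S ⊩c substS (single x t) φ → S ⊩c ∃' x φ
    ∀'  : ∀ {x φ} → (∀ t → ClosedT t → S ⊩c substS (single x t) φ) → S ⊩c ∀' x φ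

  Inconsistent : ∀ {ℓ} → (Lit → Set ℓ) → Set ℓ
  Inconsistent S = Σ Pred λ p → Σ (Vec Term (parity p)) λ ts →
                     InstOf S (pos p ts) × InstOf S (neg p ts)

  _⊩_ : ∀ {ℓ} → (Lit → Set ℓ) → Stmt → Set (lsuc lzero ⊔ ℓ)
  S ⊩ φ = Inconsistent S ⊎
          (∀ σ → ClosedSub σ → ClosedS (substS σ φ) → InstOf S ⊩c substS σ φ)

  -- φ⁺ ℘, φ⁻ ℘ (only the values at predicate symbols of 𝒱★ matter)
  record Program : Set₁ where
    field
      φ⁺ : Pred → Stmt
      φ⁻ : Pred → Stmt
  open Program public

  FreeAmong : ℕ → Stmt → Set₁
  FreeAmong n φ = ∀ x → Free x φ → (1 ≤ x) × (x ≤ n)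

  record IsFormalProgram (P : Program) : Set₁ where
    field
      wf⁺ : ∀ p → Pred★ p → Stmt★ (φ⁺ P p) × FreeAmong (parity p) (φ⁺ P p)
      wf⁻ : ∀ p → Pred★ p → Stmt★ (φ⁻ P p) × FreeAmong (parity p) (φ⁻ P p)

  record IsModel (P : Program) (A : Lit → Set₁) : Set₁ where
    field
      over★ : ∀ l → A l → Lit★ l
      pos⇒ : ∀ p → Pred★ p → (ts : Vec Term (parity p)) → Terms★ ts →
             A (pos p ts) → ∀ ts' → InstTs ts' ts → A ⊩ substS (vsub ts') (φ⁺ P p)
      ⇒pos : ∀ p → Pred★ p → (ts : Vec Term (parity p)) → Terms★ ts →
             (∀ ts' → InstTs ts' ts → A ⊩ substS (vsub ts') (φ⁺ P p)) → A (pos p ts)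
      neg⇒ : ∀ p → Pred★ p → (ts : Vec Term (parity p)) → Terms★ ts →
             A (neg p ts) → ∀ ts' → InstTs ts' ts → A ⊩ substS (vsub ts') (φ⁻ P p)
      ⇒neg : ∀ p → Pred★ p → (ts : Vec Term (parity p)) → Terms★ ts →
             (∀ ts' → InstTs ts' ts → A ⊩ substS (vsub ts') (φ⁻ P p)) → A (neg p ts)

  IsDenotation : Program → (Lit → Set₁) → Set₂
  IsDenotation P A = IsModel P A × (∀ (C : Lit → Set₁) → IsModel P C → ∀ l → A l → C l)

  -- a path from the root of the parse tree of φ to a literal leaf
  data Occ : Stmt → Set₁ where
    here : ∀ {l} → Occ (lit l)
    ⋁    : ∀ {I} {X : I → Stmt} (i : I) → Occ (X i) → Occ (⋁ X)
    ⋀    : ∀ {I} {X : I → Stmt} (i : I) → Occ (X i) → Occ (⋀ X)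
    ∃'   : ∀ {x φ} → Occ φ → Occ (∃' x φ)
    ∀'   : ∀ {x φ} → Occ φ → Occ (∀' x φ)

  -- a set O of occurrences, given by its characteristic function
  record Marker (P : Program) : Set₁ where
    field
      O⁺ : (p : Pred) → Occ (φ⁺ P p) → Bool
      O⁻ : (p : Pred) → Occ (φ⁻ P p) → Bool
  open Marker public

  -- the data determining one member ∃y₁…∃yₘ(x₁≐t₁ ∧ … ∧ xₙ≐tₙ) of U(λ,E)
  record UData (l : Lit) (E : Lit → Set) : Set where
    field
      xs       : List ℕ
      xs-uniq  : Unique xs
      xs-exact : ∀ x → (x ∈ xs → FreeL x l) × (FreeL x l → x ∈ xs)
      ts       : Vec Term (length xs)
      ts★      : Terms★ ts
      ys       : List ℕ
      ys-uniq  : Unique ys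
      ys-exact : ∀ y → (y ∈ ys → OccTs y ts) × (OccTs y ts → y ∈ ys)
      ys-fresh : ∀ y → y ∈ ys → y ∉ xs
      cond     : ∀ ts' → InstTs ts' ts → InstOf E (substL (assign xs ts') l)

  exists* : List ℕ → Stmt → Stmt
  exists* List.[]       φ = φ
  exists* (y List.∷ ys) φ = ∃' y (exists* ys φ)

  -- x₁≐t₁ ∧ … ∧ xₙ≐tₙ  as  ⋀{x₁≐t₁,…,xₙ≐tₙ}   (n = 0 gives ⋀∅)
  identities : (xs : List ℕ) → Vec Term (length xs) → Stmt
  identities xs ts = ⋀ {Fin (length xs)} (λ k → var (List.lookup xs k) ≐ Vec.lookup ts k)

  UStmt : ∀ {l E} → UData l E → Stmt
  UStmt u = exists* (UData.ys u) (identities (UData.xs u) (UData.ts u))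

  widen : (Lit → Set) → Lit → Stmt
  widen E l = ⋁ {⊤ ⊎ UData l E} [ (λ _ → lit l) , UStmt ]

  ⊚ : (E : Lit → Set) → (φ : Stmt) → (Occ φ → Bool) → Stmt
  ⊚ E (lit l)  O = if O here then widen E l else lit l
  ⊚ E (t ≐ t') O = t ≐ t'
  ⊚ E (t ≭ t') O = t ≭ t'
  ⊚ E (⋁ X)    O = ⋁ (λ i → ⊚ E (X i) (λ o → O (⋁ i o)))
  ⊚ E (⋀ X)    O = ⋀ (λ i → ⊚ E (X i) (λ o → O (⋀ i o)))
  ⊚ E (∃' x φ) O = ∃' x (⊚ E φ (λ o → O (∃' o)))
  ⊚ E (∀' x φ) O = ∀' x (⊚ E φ (λ o → O (∀' o)))

  _+[_]_ : (P : Program) → Marker P → (Lit → Set) → Program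
  φ⁺ (P +[ Ω ] E) p = ⊚ E (φ⁺ P p) (O⁺ Ω p)
  φ⁻ (P +[ Ω ] E) p = ⊚ E (φ⁻ P p) (O⁻ Ω p)

-- Enlarging E only adds disjuncts to ⊚^O_E φ, so forcing in 𝒫 +_Ω E implies forcing in
-- 𝒫 +_Ω F.  Hence [𝒫 +_Ω F] is closed under the rules of 𝒫 +_Ω E.  Since [𝒫 +_Ω E] is
-- contained in the inductively generated model of 𝒫 +_Ω E, which lies below every set
-- closed under its rules, the inclusion follows.
module Submission where

open import Defs
open import Data.Bool using (Bool; true; false)
open import Data.Product using (_,_)
open import Data.Sum using (_⊎_; inj₁; inj₂; [_,_])
import Data.Sum as Sum
open import Data.Vec using (Vec)
open import Function using (id)

module _ (V : Vocabulary) where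
  open Vocabulary V
  open Syntax V

  infix 4 _≼_
  data _≼_ : Stmt → Stmt → Set₁ where
    lit : ∀ {l} → lit l ≼ lit l
    eq  : ∀ {t t'} → (t ≐ t') ≼ (t ≐ t')
    neq : ∀ {t t'} → (t ≭ t') ≼ (t ≭ t')
    ⋁   : ∀ {I J} {X : I → Stmt} {Y : J → Stmt} (g : I → J) →
          (∀ i → X i ≼ Y (g i)) → ⋁ X ≼ ⋁ Y
    ⋀   : ∀ {I} {X Y : I → Stmt} → (∀ i → X i ≼ Y i) → ⋀ X ≼ ⋀ Y
    ∃'  : ∀ {x φ ψ} → φ ≼ ψ → ∃' x φ ≼ ∃' x ψ
    ∀'  : ∀ {x φ ψ} → φ ≼ ψ → ∀' x φ ≼ ∀' x ψ

  ≼-refl : ∀ φ → φ ≼ φ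
  ≼-refl (lit l)  = lit
  ≼-refl (t ≐ t') = eq
  ≼-refl (t ≭ t') = neq
  ≼-refl (⋁ X)    = ⋁ id (λ i → ≼-refl (X i))
  ≼-refl (⋀ X)    = ⋀ (λ i → ≼-refl (X i))
  ≼-refl (∃' x φ) = ∃' (≼-refl φ)
  ≼-refl (∀' x φ) = ∀' (≼-refl φ)

  ≼-substS : ∀ σ {φ ψ} → φ ≼ ψ → substS σ φ ≼ substS σ ψ
  ≼-substS σ lit      = lit
  ≼-substS σ eq       = eq
  ≼-substS σ neq      = neq
  ≼-substS σ (⋁ g w)  = ⋁ g (λ i → ≼-substS σ (w i))
  ≼-substS σ (⋀ w)    = ⋀ (λ i → ≼-substS σ (w i))
  ≼-substS σ (∃' w)   = ∃' (≼-substS _ w)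
  ≼-substS σ (∀' w)   = ∀' (≼-substS _ w)

  ≼-Free : ∀ {x φ ψ} → φ ≼ ψ → Free x φ → Free x ψ
  ≼-Free lit      f          = f
  ≼-Free eq       f          = f
  ≼-Free neq      f          = f
  ≼-Free (⋁ g w)  (⋁ i f)    = ⋁ (g i) (≼-Free (w i) f)
  ≼-Free (⋀ w)    (⋀ i f)    = ⋀ i (≼-Free (w i) f)
  ≼-Free (∃' w)   (∃' x≢ f)  = ∃' x≢ (≼-Free w f)
  ≼-Free (∀' w)   (∀' x≢ f)  = ∀' x≢ (≼-Free w f)

  ⊩c-≼ : ∀ {ℓ} {S : Lit → Set ℓ} {φ ψ} → φ ≼ ψ → S ⊩c φ → S ⊩c ψ
  ⊩c-≼ lit     s            = s
  ⊩c-≼ eq      s            = s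
  ⊩c-≼ neq     s            = s
  ⊩c-≼ (⋁ g w) (⋁ i s)      = ⋁ (g i) (⊩c-≼ (w i) s)
  ⊩c-≼ (⋀ w)   (⋀ s)        = ⋀ (λ i → ⊩c-≼ (w i) (s i))
  ⊩c-≼ (∃' w)  (∃' t ct s)  = ∃' t ct (⊩c-≼ (≼-substS _ w) s)
  ⊩c-≼ (∀' w)  (∀' s)       = ∀' (λ t ct → ⊩c-≼ (≼-substS _ w) (s t ct))

  -- Closed instances of ψ restrict to closed instances of φ because ≼ cannot create free variables.
  ⊩-≼ : ∀ {ℓ} {S : Lit → Set ℓ} {φ ψ} → φ ≼ ψ → S ⊩ φ → S ⊩ ψ
  ⊩-≼ w (inj₁ inconsistent) = inj₁ inconsistent
  ⊩-≼ w (inj₂ s) = inj₂ λ σ cσ closed →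
    ⊩c-≼ (≼-substS σ w) (s σ cσ (λ x free → closed x (≼-Free (≼-substS σ w) free)))

  module _ {E F : Lit → Set} (E⊆F : ∀ l → E l → F l) where

    UData-mono : ∀ {l} → UData l E → UData l F
    UData-mono u = record
      { xs = xs ; xs-uniq = xs-uniq ; xs-exact = xs-exact ; ts = ts ; ts★ = ts★
      ; ys = ys ; ys-uniq = ys-uniq ; ys-exact = ys-exact ; ys-fresh = ys-fresh
      ; cond = λ ts' inst → let (l' , e , i) = cond ts' inst in l' , E⊆F l' e , i }
      where open UData u

    widen-mono : ∀ l → widen E l ≼ widen F l
    widen-mono l = ⋁ (Sum.map id UData-mono) disjunct
      where
      disjunct : ∀ i → [ (λ _ → lit l) , UStmt ] i
                       ≼ [ (λ _ → lit l) , UStmt ] (Sum.map id UData-mono i)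
      disjunct (inj₁ _) = lit
      disjunct (inj₂ u) = ≼-refl (UStmt u)

    ⊚-mono : ∀ φ (O : Occ φ → Bool) → ⊚ E φ O ≼ ⊚ F φ O
    ⊚-mono (lit l)  O with O here
    ... | true  = widen-mono l
    ... | false = lit
    ⊚-mono (t ≐ t') O = eq
    ⊚-mono (t ≭ t') O = neq
    ⊚-mono (⋁ X)    O = ⋁ id (λ i → ⊚-mono (X i) _)
    ⊚-mono (⋀ X)    O = ⋀ (λ i → ⊚-mono (X i) _)
    ⊚-mono (∃' x φ) O = ∃' (⊚-mono φ _)
    ⊚-mono (∀' x φ) O = ∀' (⊚-mono φ _)

  record IsRuleClosed (Q : Program) (B : Lit → Set₁) : Set₁ where
    field
      ⇒pos : ∀ p → Pred★ p → (ts : Vec Term (parity p)) → Terms★ ts →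
             (∀ ts' → InstTs ts' ts → B ⊩ substS (vsub ts') (φ⁺ Q p)) → B (pos p ts)
      ⇒neg : ∀ p → Pred★ p → (ts : Vec Term (parity p)) → Terms★ ts →
             (∀ ts' → InstTs ts' ts → B ⊩ substS (vsub ts') (φ⁻ Q p)) → B (neg p ts)

  isModel⇒isRuleClosed : ∀ {Q B} → IsModel Q B → IsRuleClosed Q B
  isModel⇒isRuleClosed m = record { ⇒pos = IsModel.⇒pos m ; ⇒neg = IsModel.⇒neg m }

  data Derivable (Q : Program) : Lit → Set₁ where
    pos : ∀ p → Pred★ p → (ts : Vec Term (parity p)) → Terms★ ts →
          (∀ ts' → InstTs ts' ts → Derivable Q ⊩ substS (vsub ts') (φ⁺ Q p)) →
          Derivable Q (pos p ts)
    neg : ∀ p → Pred★ p → (ts : Vec Term (parity p)) → Terms★ ts →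
          (∀ ts' → InstTs ts' ts → Derivable Q ⊩ substS (vsub ts') (φ⁻ Q p)) →
          Derivable Q (neg p ts)

  Derivable-isModel : ∀ Q → IsModel Q (Derivable Q)
  Derivable-isModel Q = record
    { over★ = λ { _ (pos _ p★ _ ts★ _) → p★ , ts★ ; _ (neg _ p★ _ ts★ _) → p★ , ts★ }
    ; pos⇒ = λ { _ _ _ _ (pos _ _ _ _ s) → s }
    ; ⇒pos = pos
    ; neg⇒ = λ { _ _ _ _ (neg _ _ _ _ s) → s }
    ; ⇒neg = neg }

  module _ {Q : Program} {B : Lit → Set₁} (closed : IsRuleClosed Q B) where
    open IsRuleClosed closed

    -- Forcing is transported along the inclusion inline, so that termination is structural.
    mutual
      Derivable⊆ : ∀ {l} → Derivable Q l → B l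
      Derivable⊆ (pos p p★ ts ts★ s) = ⇒pos p p★ ts ts★ (λ ts' inst → ⊩-Derivable⊆ (s ts' inst))
      Derivable⊆ (neg p p★ ts ts★ s) = ⇒neg p p★ ts ts★ (λ ts' inst → ⊩-Derivable⊆ (s ts' inst))

      ⊩-Derivable⊆ : ∀ {φ} → Derivable Q ⊩ φ → B ⊩ φ
      ⊩-Derivable⊆ (inj₁ (p , ts , (l⁺ , d⁺ , i⁺) , (l⁻ , d⁻ , i⁻))) =
        inj₁ (p , ts , (l⁺ , Derivable⊆ d⁺ , i⁺) , (l⁻ , Derivable⊆ d⁻ , i⁻))
      ⊩-Derivable⊆ (inj₂ s) = inj₂ λ σ cσ cl → ⊩c-Derivable⊆ (s σ cσ cl)

      ⊩c-Derivable⊆ : ∀ {φ} → InstOf (Derivable Q) ⊩c φ → InstOf B ⊩c φ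
      ⊩c-Derivable⊆ (lit (l , d , i)) = lit (l , Derivable⊆ d , i)
      ⊩c-Derivable⊆ (eq e)            = eq e
      ⊩c-Derivable⊆ (neq e)           = neq e
      ⊩c-Derivable⊆ (⋁ i s)           = ⋁ i (⊩c-Derivable⊆ s)
      ⊩c-Derivable⊆ (⋀ s)             = ⋀ (λ i → ⊩c-Derivable⊆ (s i))
      ⊩c-Derivable⊆ (∃' t ct s)       = ∃' t ct (⊩c-Derivable⊆ s)
      ⊩c-Derivable⊆ (∀' s)            = ∀' (λ t ct → ⊩c-Derivable⊆ (s t ct))

  denotation⊆ruleClosed : ∀ {Q A B} → IsDenotation Q A → IsRuleClosed Q B → ∀ l → A l → B l
  denotation⊆ruleClosed {Q} (_ , least) closed l a =
    Derivable⊆ closed (least (Derivable Q) (Derivable-isModel Q) l a)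

  +-model⇒ruleClosed : ∀ {P} (Ω : Marker P) {E F : Lit → Set} → (∀ l → E l → F l) →
                       ∀ {B} → IsModel (P +[ Ω ] F) B → IsRuleClosed (P +[ Ω ] E) B
  +-model⇒ruleClosed {P} Ω E⊆F m = record
    { ⇒pos = λ p p★ ts ts★ s → ⇒pos p p★ ts ts★ λ ts' inst →
               ⊩-≼ (≼-substS (vsub ts') (⊚-mono E⊆F (φ⁺ P p) (O⁺ Ω p))) (s ts' inst)
    ; ⇒neg = λ p p★ ts ts★ s → ⇒neg p p★ ts ts★ λ ts' inst →
               ⊩-≼ (≼-substS (vsub ts') (⊚-mono E⊆F (φ⁻ P p) (O⁻ Ω p))) (s ts' inst) }
    where open IsModel m

lemma55 : (V : Vocabulary) → let open Syntax V in
          (P : Program) → IsFormalProgram P → (Ω : Marker P) →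
          (E F : Lit → Set) → (∀ l → E l → F l) →
          (A B : Lit → Set₁) → IsDenotation (P +[ Ω ] E) A → IsDenotation (P +[ Ω ] F) B →
          ∀ l → A l → B l
lemma55 V P _ Ω E F E⊆F A B denA (modelB , _) =
  denotation⊆ruleClosed V denA (+-model⇒ruleClosed V Ω E⊆F modelB)
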